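{- Let $k \geq 1$ be an integer and let $\mathrm{Cat}(k) = \frac{1}{k+1}\binom{2k}{k}$ be the $k$-th Catalan number. Then (i) $U_{n,k} = 0$ for every $n < 2k$; (ii) $U_{2k,k} = \mathrm{Cat}(k)$; (iii) $U_{2k+1,k} = 2k\cdot \mathrm{Cat}(k)$; (iv) $U_{2k+2,k} = k(2k+1)\cdot \mathrm{Cat}(k)$.
   Context: A Motzkin word of length $n$ is a string over the alphabet $\{0, (, )\}$ in which the numbers of left and right parentheses are equal and in every prefix the number of left parentheses is at least the number of right parentheses. The parentheses of such a word decompose uniquely into matched pairs. For $n\ge 1$ and $k\ge 1$, $U_{n,k}$ denotes the number of Motzkin words of length $n$ that begin with a left parenthesis and contain exactly $k$ matched pairs of parentheses (i.e. exactly $k$ left parentheses). -}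

module Defs where

open import Data.Nat using (ℕ; zero; suc; _+_; _*_; _/_)
open import Data.Nat.Combinatorics using (_C_)
open import Data.Bool using (Bool; true; false; _∧_)
open import Data.List using (List; []; _∷_; map; concatMap; filter; length)
open import Data.Nat.Properties using (_≟_)
open import Relation.Nullary.Decidable using (⌊_⌋)
open import Relation.Binary.PropositionalEquality using (_≡_)
open import Function using (_∘_)
open import Data.Bool using (T?)

data Letter : Set where
  o  : Letter
  lp : Letter
  rp : Letter

Word : Set
Word = List Letter

words : ℕ → List Word
words zero    = [] ∷ []
words (suc n) = concatMap (λ w → (o ∷ w) ∷ (lp ∷ w) ∷ (rp ∷ w) ∷ []) (words n)

-- motzkinFrom h w: reading w after a prefix with (#lp − #rp) = h ≥ 0,
-- every prefix keeps #lp ≥ #rp and the totals are equal at the end.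
motzkinFrom : ℕ → Word → Bool
motzkinFrom zero    []       = true
motzkinFrom (suc h) []       = false
motzkinFrom h       (o  ∷ w) = motzkinFrom h w
motzkinFrom h       (lp ∷ w) = motzkinFrom (suc h) w
motzkinFrom zero    (rp ∷ w) = false
motzkinFrom (suc h) (rp ∷ w) = motzkinFrom h w

isMotzkin : Word → Bool
isMotzkin = motzkinFrom 0

startsWithLp : Word → Bool
startsWithLp (lp ∷ _) = true
startsWithLp _        = false

countLp : Word → ℕ
countLp []       = 0
countLp (lp ∷ w) = suc (countLp w)
countLp (_  ∷ w) = countLp w

countedBy : ℕ → Word → Bool
countedBy k w = isMotzkin w ∧ startsWithLp w ∧ ⌊ countLp w ≟ k ⌋

U : ℕ → ℕ → ℕ
U n k = length (filter (T? ∘ countedBy k) (words n))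

-- k-th Catalan number (1/(k+1)) * binom(2k,k); exact division
Cat : ℕ → ℕ
Cat k = ((2 * k) C k) / suc k

-- A word closing a prefix of height h with k left parentheses has exactly h + 2k
-- parenthesis letters, and the 0s may occupy any of the other positions. Hence among the
-- words of length n there are C(n, h + 2k) · ballot h k of them, where ballot h k counts the
-- 0-free ones and equals C(h + 2k, k) - C(h + 2k, k - 1) (reflection principle); both
-- formulas are checked against the recursion on the first letter. A word counted by
-- U (n + 1) (k + 1) is ( followed by such a word with h = 1, so
-- U (n + 1) (k + 1) = C(n, 2k + 1) · Cat (k + 1), and the four claims are the values of
-- C(n, 2k + 1) for n < 2k + 1 and n = 2k + 1, 2k + 2, 2k + 3.

module Submission where

open import Defs
open import Data.Nat using (ℕ; _*_; _+_; _<_; _≥_)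
open import Data.Product using (_×_)
open import Relation.Binary.PropositionalEquality using (_≡_)

open import Data.Bool using (Bool; true; false; _∧_; T?)
open import Data.Bool.Properties using (∧-zeroʳ)
open import Data.List using (List; []; _∷_; _++_; filter; length; concatMap)
open import Data.Nat using (zero; suc; s≤s; z≤n; _/_)
open import Data.Nat.Combinatorics
  using (_C_; k>n⇒nCk≡0; nCk≡nC[n∸k]; nCn≡1; nC1≡n)
  renaming (nCk+nC[k+1]≡[n+1]C[k+1] to pascal)
open import Data.Nat.DivMod using (m*n/n≡m)
open import Data.Nat.Properties
open import Data.Nat.Tactic.RingSolver using (solve-∀)
open import Data.Product using (_,_)
open import Function using (_∘_)
open import Relation.Binary.PropositionalEquality
  using (refl; sym; trans; cong; cong₂; ≢-≟-identity; module ≡-Reasoning)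
open import Relation.Nullary using (yes; no)
open import Relation.Nullary.Decidable using (⌊_⌋)

private
  variable
    A : Set

indicator : Bool → ℕ
indicator true  = 1
indicator false = 0

count : (A → Bool) → List A → ℕ
count p []       = 0
count p (x ∷ xs) = indicator (p x) + count p xs

length-filter-T? : (p : A → Bool) (xs : List A) →
                   length (filter (T? ∘ p) xs) ≡ count p xs
length-filter-T? p []       = refl
length-filter-T? p (x ∷ xs) with p x
... | true  = cong suc (length-filter-T? p xs)
... | false = length-filter-T? p xs

count-++ : (p : A → Bool) (xs ys : List A) →
           count p (xs ++ ys) ≡ count p xs + count p ys
count-++ p []       ys = refl
count-++ p (x ∷ xs) ys =
  trans (cong (indicator (p x) +_) (count-++ p xs ys))
        (sym (+-assoc (indicator (p x)) (count p xs) (count p ys)))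

count-cong : {p q : A → Bool} → (∀ x → p x ≡ q x) → (xs : List A) →
             count p xs ≡ count q xs
count-cong p≗q []       = refl
count-cong p≗q (x ∷ xs) = cong₂ _+_ (cong indicator (p≗q x)) (count-cong p≗q xs)

count-false : {p : A → Bool} → (∀ x → p x ≡ false) → (xs : List A) →
              count p xs ≡ 0
count-false p≗false []       = refl
count-false p≗false (x ∷ xs) rewrite p≗false x = count-false p≗false xs

count-words-suc : ∀ (p : Word → Bool) n →
  count p (words (suc n)) ≡
  count (p ∘ (o ∷_)) (words n) + count (p ∘ (lp ∷_)) (words n)
    + count (p ∘ (rp ∷_)) (words n)
count-words-suc p n = go (words n)
  where
  extensions : Word → List Word
  extensions w = (o ∷ w) ∷ (lp ∷ w) ∷ (rp ∷ w) ∷ []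

  interchange : ∀ a b c x y z → a + (b + (c + 0)) + (x + y + z) ≡ (a + x) + (b + y) + (c + z)
  interchange = solve-∀

  go : (ws : List Word) → count p (concatMap extensions ws) ≡
       count (p ∘ (o ∷_)) ws + count (p ∘ (lp ∷_)) ws + count (p ∘ (rp ∷_)) ws
  go []       = refl
  go (w ∷ ws) =
    trans (count-++ p (extensions w) (concatMap extensions ws))
          (trans (cong (count p (extensions w) +_) (go ws))
                 (interchange (c (o ∷ w)) (c (lp ∷ w)) (c (rp ∷ w)) _ _ _))
    where c = indicator ∘ p

isYes-suc≟suc : ∀ m n → ⌊ suc m ≟ suc n ⌋ ≡ ⌊ m ≟ n ⌋
isYes-suc≟suc m n with m ≟ n
... | yes m≡n = cong ⌊_⌋ (≟-diag (cong suc m≡n))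
... | no  m≢n = cong ⌊_⌋ (≢-≟-identity _≟_ (m≢n ∘ suc-injective))

closesFrom : ℕ → ℕ → Word → Bool
closesFrom h k w = motzkinFrom h w ∧ ⌊ countLp w ≟ k ⌋

closesFrom-o : ∀ h k w → closesFrom h k (o ∷ w) ≡ closesFrom h k w
closesFrom-o zero    k w = refl
closesFrom-o (suc h) k w = refl

closesFrom-lp-zero : ∀ h w → closesFrom h 0 (lp ∷ w) ≡ false
closesFrom-lp-zero zero    w = ∧-zeroʳ (motzkinFrom 1 w)
closesFrom-lp-zero (suc h) w = ∧-zeroʳ (motzkinFrom (suc (suc h)) w)

closesFrom-lp-suc : ∀ h k w → closesFrom h (suc k) (lp ∷ w) ≡ closesFrom (suc h) k w
closesFrom-lp-suc zero    k w = cong (motzkinFrom 1 w ∧_) (isYes-suc≟suc (countLp w) k)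
closesFrom-lp-suc (suc h) k w =
  cong (motzkinFrom (suc (suc h)) w ∧_) (isYes-suc≟suc (countLp w) k)

closings : ℕ → ℕ → ℕ → ℕ
closings n h k = count (closesFrom h k) (words n)

closingsAfterLp : ℕ → ℕ → ℕ → ℕ
closingsAfterLp n h zero    = 0
closingsAfterLp n h (suc k) = closings n (suc h) k

closingsAfterRp : ℕ → ℕ → ℕ → ℕ
closingsAfterRp n zero    k = 0
closingsAfterRp n (suc h) k = closings n h k

closings-suc : ∀ n h k →
  closings (suc n) h k ≡ closings n h k + closingsAfterLp n h k + closingsAfterRp n h k
closings-suc n h k = begin
  closings (suc n) h k
    ≡⟨ count-words-suc (closesFrom h k) n ⟩
  count (closesFrom h k ∘ (o ∷_)) ws + count (closesFrom h k ∘ (lp ∷_)) ws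
    + count (closesFrom h k ∘ (rp ∷_)) ws
    ≡⟨ cong₂ (λ x y → x + y + count (closesFrom h k ∘ (rp ∷_)) ws)
             (count-cong (closesFrom-o h k) ws) (afterLp k) ⟩
  closings n h k + closingsAfterLp n h k + count (closesFrom h k ∘ (rp ∷_)) ws
    ≡⟨ cong (closings n h k + closingsAfterLp n h k +_) (afterRp h) ⟩
  closings n h k + closingsAfterLp n h k + closingsAfterRp n h k ∎
  where
  open ≡-Reasoning
  ws = words n

  afterLp : ∀ k → count (closesFrom h k ∘ (lp ∷_)) ws ≡ closingsAfterLp n h k
  afterLp zero    = count-false (closesFrom-lp-zero h) ws
  afterLp (suc k) = count-cong (closesFrom-lp-suc h k) ws

  afterRp : ∀ h → count (closesFrom h k ∘ (rp ∷_)) ws ≡ closingsAfterRp n h k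
  afterRp zero    = count-false (λ _ → refl) ws
  afterRp (suc h) = refl

pascal-* : ∀ n {i j} d → i ≡ suc j → (n C i) * d + (n C j) * d ≡ (suc n C i) * d
pascal-* n {j = j} d refl = begin
  (n C suc j) * d + (n C j) * d ≡⟨ *-distribʳ-+ d (n C suc j) (n C j) ⟨
  (n C suc j + n C j) * d       ≡⟨ cong (_* d) (+-comm (n C suc j) (n C j)) ⟩
  (n C j + n C suc j) * d       ≡⟨ cong (_* d) (pascal n j) ⟩
  (suc n C suc j) * d           ∎
  where open ≡-Reasoning

pascal-combine : ∀ {n m i k} a b → n ≡ suc m →
  a + m C suc i ≡ m C k → b + m C i ≡ m C suc k → a + b + n C suc i ≡ n C suc k
pascal-combine {m = m} {i} {k} a b refl hA hB = begin
  a + b + suc m C suc i               ≡⟨ cong (a + b +_) (pascal m i) ⟨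
  a + b + (m C i + m C suc i)         ≡⟨ interchange a b (m C i) (m C suc i) ⟩
  (a + m C suc i) + (b + m C i)       ≡⟨ cong₂ _+_ hA hB ⟩
  m C k + m C suc k                   ≡⟨ pascal m k ⟩
  suc m C suc k                       ∎
  where
  open ≡-Reasoning
  interchange : ∀ a b x y → a + b + (x + y) ≡ (a + y) + (b + x)
  interchange = solve-∀

C-sym : ∀ m n → (m + n) C m ≡ (m + n) C n
C-sym m n = trans (nCk≡nC[n∸k] (m≤m+n m n)) (cong ((m + n) C_) (m+n∸m≡n m n))

C-absorb : ∀ n k → suc k * (suc n C suc k) ≡ suc n * (n C k)
C-absorb zero    zero    = refl
C-absorb zero    (suc k) =
  trans (cong (suc (suc k) *_) (k>n⇒nCk≡0 (s≤s (s≤s (z≤n {k}))))) (*-zeroʳ (suc (suc k)))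
C-absorb (suc n) zero    =
  trans (*-identityˡ (suc (suc n) C 1))
        (trans (nC1≡n (suc (suc n))) (sym (*-identityʳ (suc (suc n)))))
C-absorb (suc n) (suc k) = begin
  suc (suc k) * (suc (suc n) C suc (suc k))
    ≡⟨ cong (suc (suc k) *_) (pascal (suc n) (suc k)) ⟨
  suc (suc k) * (c₁ + c₂)
    ≡⟨ distribute (suc k) c₁ c₂ ⟩
  c₁ + suc k * c₁ + suc (suc k) * c₂
    ≡⟨ cong₂ (λ x y → c₁ + x + y) (C-absorb n k) (C-absorb n (suc k)) ⟩
  c₁ + suc n * (n C k) + suc n * (n C suc k)
    ≡⟨ collect (suc n) c₁ (n C k) (n C suc k) ⟩
  c₁ + suc n * (n C k + n C suc k)
    ≡⟨ cong (λ x → c₁ + suc n * x) (pascal n k) ⟩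
  suc (suc n) * c₁ ∎
  where
  open ≡-Reasoning
  c₁ = suc n C suc k
  c₂ = suc n C suc (suc k)
  distribute : ∀ k x y → suc k * (x + y) ≡ x + k * x + suc k * y
  distribute = solve-∀
  collect : ∀ n c x y → c + n * x + n * y ≡ c + n * (x + y)
  collect = solve-∀

C-central-absorb : ∀ k → suc k * ((k + k) C suc k) ≡ k * ((k + k) C k)
C-central-absorb zero    = refl
C-central-absorb (suc k) = begin
  suc (suc k) * (suc X C suc (suc k)) ≡⟨ C-absorb X (suc k) ⟩
  suc X * (X C suc k)                 ≡⟨ cong (suc X *_) (C-sym k (suc k)) ⟨
  suc X * (X C k)                     ≡⟨ C-absorb X k ⟨
  suc k * (suc X C suc k)             ∎
  where
  open ≡-Reasoning
  X = k + suc k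

[1+n]Cn≡1+n : ∀ n → suc n C n ≡ suc n
[1+n]Cn≡1+n n = begin
  suc n C n     ≡⟨ cong (_C n) (+-comm 1 n) ⟩
  (n + 1) C n   ≡⟨ C-sym n 1 ⟩
  (n + 1) C 1   ≡⟨ nC1≡n (n + 1) ⟩
  n + 1         ≡⟨ +-comm n 1 ⟩
  suc n         ∎
  where open ≡-Reasoning

[1+n]C2*2 : ∀ n → (suc n C 2) * 2 ≡ suc n * n
[1+n]C2*2 zero    = refl
[1+n]C2*2 (suc n) = begin
  (suc (suc n) C 2) * 2        ≡⟨ cong (_* 2) (pascal (suc n) 1) ⟨
  (suc n C 1 + suc n C 2) * 2  ≡⟨ cong (λ x → (x + suc n C 2) * 2) (nC1≡n (suc n)) ⟩
  (suc n + suc n C 2) * 2      ≡⟨ *-distribʳ-+ 2 (suc n) (suc n C 2) ⟩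
  suc n * 2 + (suc n C 2) * 2  ≡⟨ cong (suc n * 2 +_) ([1+n]C2*2 n) ⟩
  suc n * 2 + suc n * n        ≡⟨ simplify n ⟩
  suc (suc n) * suc n          ∎
  where
  open ≡-Reasoning
  simplify : ∀ n → suc n * 2 + suc n * n ≡ suc (suc n) * suc n
  simplify = solve-∀

[2+n]Cn*2 : ∀ n → (suc (suc n) C n) * 2 ≡ suc (suc n) * suc n
[2+n]Cn*2 n = begin
  (suc (suc n) C n) * 2  ≡⟨ cong (λ x → (x C n) * 2) (+-comm 2 n) ⟩
  ((n + 2) C n) * 2      ≡⟨ cong (_* 2) (C-sym n 2) ⟩
  ((n + 2) C 2) * 2      ≡⟨ cong (λ x → (x C 2) * 2) (+-comm n 2) ⟩
  (suc (suc n) C 2) * 2  ≡⟨ [1+n]C2*2 (suc n) ⟩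
  suc (suc n) * suc n    ∎
  where open ≡-Reasoning

ballot : ℕ → ℕ → ℕ
ballot zero    zero    = 1
ballot (suc h) zero    = ballot h zero
ballot zero    (suc k) = ballot 1 k
ballot (suc h) (suc k) = ballot (suc (suc h)) k + ballot h (suc k)

len : ℕ → ℕ → ℕ
len h k = h + k + k

len-suc : ∀ h k → len h (suc k) ≡ len (suc (suc h)) k
len-suc h k = trans (+-suc (h + suc k) k) (cong (suc ∘ (_+ k)) (+-suc h k))

ballot-zero : ∀ h → ballot h 0 ≡ 1
ballot-zero zero    = refl
ballot-zero (suc h) = ballot-zero h

closings≡C*ballot : ∀ n h k → closings n h k ≡ (n C len h k) * ballot h k
closings≡C*ballot zero    zero    zero    = refl
closings≡C*ballot zero    (suc h) k       = refl
closings≡C*ballot zero    zero    (suc k) = refl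
closings≡C*ballot (suc n) h       k       = trans (closings-suc n h k) (step h k)
  where
  open ≡-Reasoning

  step : ∀ h k → closings n h k + closingsAfterLp n h k + closingsAfterRp n h k
                 ≡ (suc n C len h k) * ballot h k
  step zero    zero    = cong (λ x → x + 0 + 0) (closings≡C*ballot n 0 0)
  step (suc h) zero    = begin
    closings n (suc h) 0 + 0 + closings n h 0
      ≡⟨ cong (_+ closings n h 0) (+-identityʳ (closings n (suc h) 0)) ⟩
    closings n (suc h) 0 + closings n h 0
      ≡⟨ cong₂ _+_ (closings≡C*ballot n (suc h) 0) (closings≡C*ballot n h 0) ⟩
    (n C len (suc h) 0) * ballot h 0 + (n C len h 0) * ballot h 0
      ≡⟨ pascal-* n (ballot h 0) refl ⟩
    (suc n C len (suc h) 0) * ballot h 0 ∎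
  step zero    (suc k) = begin
    closings n 0 (suc k) + closings n 1 k + 0
      ≡⟨ +-identityʳ (closings n 0 (suc k) + closings n 1 k) ⟩
    closings n 0 (suc k) + closings n 1 k
      ≡⟨ cong₂ _+_ (closings≡C*ballot n 0 (suc k)) (closings≡C*ballot n 1 k) ⟩
    (n C len 0 (suc k)) * ballot 1 k + (n C len 1 k) * ballot 1 k
      ≡⟨ pascal-* n (ballot 1 k) (len-suc 0 k) ⟩
    (suc n C len 0 (suc k)) * ballot 1 k ∎
  step (suc h) (suc k) = begin
    closings n (suc h) (suc k) + closings n (suc (suc h)) k + closings n h (suc k)
      ≡⟨ cong₂ _+_ (cong₂ _+_ (closings≡C*ballot n (suc h) (suc k))
                              (closings≡C*ballot n (suc (suc h)) k))
                   (closings≡C*ballot n h (suc k)) ⟩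
    (n C suc j) * (b₁ + b₂) + (n C len (suc (suc h)) k) * b₁ + (n C j) * b₂
      ≡⟨ cong (λ i → (n C suc j) * (b₁ + b₂) + (n C i) * b₁ + (n C j) * b₂)
              (len-suc h k) ⟨
    (n C suc j) * (b₁ + b₂) + (n C j) * b₁ + (n C j) * b₂
      ≡⟨ +-assoc ((n C suc j) * (b₁ + b₂)) ((n C j) * b₁) ((n C j) * b₂) ⟩
    (n C suc j) * (b₁ + b₂) + ((n C j) * b₁ + (n C j) * b₂)
      ≡⟨ cong ((n C suc j) * (b₁ + b₂) +_) (*-distribˡ-+ (n C j) b₁ b₂) ⟨
    (n C suc j) * (b₁ + b₂) + (n C j) * (b₁ + b₂)
      ≡⟨ pascal-* n (b₁ + b₂) refl ⟩
    (suc n C suc j) * (b₁ + b₂) ∎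
    where
    j  = len h (suc k)
    b₁ = ballot (suc (suc h)) k
    b₂ = ballot h (suc k)

-- The second binomial is C(len h k, k - 1) by symmetry; written this way the case k = 0
-- needs no truncated subtraction.
ballot+C≡C : ∀ h k → ballot h k + len h k C suc (h + k) ≡ len h k C k
ballot+C≡C h zero = cong₂ _+_ (ballot-zero h)
  (k>n⇒nCk≡0 (s≤s (≤-reflexive (+-identityʳ (h + 0)))))
ballot+C≡C zero (suc k) =
  trans (cong (_+ len 0 (suc k) C suc (suc k)) (sym (+-identityʳ (ballot 1 k))))
        (pascal-combine {m = len 1 k} {suc k} {k}
           (ballot 1 k) 0 (len-suc 0 k) (ballot+C≡C 1 k) refl)
ballot+C≡C (suc h) (suc k) =
  pascal-combine {m = len h (suc k)} {suc (h + suc k)} {k}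
    (ballot (suc (suc h)) k) (ballot h (suc k)) refl hA (ballot+C≡C h (suc k))
  where
  hA : ballot (suc (suc h)) k + len h (suc k) C suc (suc (h + suc k)) ≡ len h (suc k) C k
  hA = begin
    ballot (suc (suc h)) k + len h (suc k) C suc (suc (h + suc k))
      ≡⟨ cong₂ (λ m i → ballot (suc (suc h)) k + m C i)
               (len-suc h k) (cong (suc ∘ suc) (+-suc h k)) ⟩
    ballot (suc (suc h)) k + len (suc (suc h)) k C suc (suc (suc h) + k)
      ≡⟨ ballot+C≡C (suc (suc h)) k ⟩
    len (suc (suc h)) k C k
      ≡⟨ cong (_C k) (len-suc h k) ⟨
    len h (suc k) C k ∎
    where open ≡-Reasoning

ballot≡Cat : ∀ k → ballot 1 k ≡ Cat (suc k)
ballot≡Cat k = sym (begin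
  Cat K                ≡⟨ cong (λ n → (n C K) / suc K) (cong (K +_) (+-identityʳ K)) ⟩
  c / suc K            ≡⟨ cong (_/ suc K) c≡b*[1+K] ⟩
  (b * suc K) / suc K  ≡⟨ m*n/n≡m b (suc K) ⟩
  b                    ∎)
  where
  open ≡-Reasoning
  K  = suc k
  b  = ballot 1 k
  c  = (K + K) C K
  c′ = (K + K) C suc K

  c≡b*[1+K] : c ≡ b * suc K
  c≡b*[1+K] = +-cancelʳ-≡ (K * c) c (b * suc K) (begin
    c + K * c              ≡⟨⟩
    suc K * c              ≡⟨ cong (suc K *_) (ballot+C≡C 0 K) ⟨
    suc K * (b + c′)       ≡⟨ *-distribˡ-+ (suc K) b c′ ⟩
    suc K * b + suc K * c′ ≡⟨ cong₂ _+_ (*-comm (suc K) b) (C-central-absorb K) ⟩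
    b * suc K + K * c      ∎)

U-suc : ∀ n k → U (suc n) (suc k) ≡ (n C suc (k + k)) * Cat (suc k)
U-suc n k = begin
  U (suc n) K
    ≡⟨ length-filter-T? (countedBy K) (words (suc n)) ⟩
  count (countedBy K) (words (suc n))
    ≡⟨ count-words-suc (countedBy K) n ⟩
  count (countedBy K ∘ (o ∷_)) ws + count (countedBy K ∘ (lp ∷_)) ws
    + count (countedBy K ∘ (rp ∷_)) ws
    ≡⟨ cong₂ (λ x y → x + y + count (countedBy K ∘ (rp ∷_)) ws)
             (count-false (λ w → ∧-zeroʳ (isMotzkin w)) ws)
             (count-cong (closesFrom-lp-suc 0 k) ws) ⟩
  closings n 1 k + count (countedBy K ∘ (rp ∷_)) ws
    ≡⟨ cong (closings n 1 k +_) (count-false (λ _ → refl) ws) ⟩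
  closings n 1 k + 0
    ≡⟨ +-identityʳ (closings n 1 k) ⟩
  closings n 1 k
    ≡⟨ closings≡C*ballot n 1 k ⟩
  (n C suc (k + k)) * ballot 1 k
    ≡⟨ cong ((n C suc (k + k)) *_) (ballot≡Cat k) ⟩
  (n C suc (k + k)) * Cat K ∎
  where
  open ≡-Reasoning
  K  = suc k
  ws = words n

proposition3p2 : (k : ℕ) → k ≥ 1 →
    ((n : ℕ) → n < 2 * k → U n k ≡ 0)
    × (U (2 * k) k ≡ Cat k)
    × (U (2 * k + 1) k ≡ (2 * k) * Cat k)
    × (U (2 * k + 2) k ≡ (k * (2 * k + 1)) * Cat k)
proposition3p2 zero    ()
proposition3p2 (suc k) _ = vanishing , central , next , next²
  where
  K = suc k
  m = suc (k + k)

  2K≡1+m : ∀ i → 2 * suc i ≡ suc (suc (i + i))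
  2K≡1+m = solve-∀

  2K+j≡ : ∀ i j → 2 * suc i + j ≡ suc (j + suc (i + i))
  2K+j≡ = solve-∀

  U-at : ∀ {n} j → n ≡ suc (j + m) → U n K ≡ ((j + m) C m) * Cat K
  U-at j refl = U-suc (j + m) k

  vanishing : (n : ℕ) → n < 2 * K → U n K ≡ 0
  vanishing zero    _    = refl
  vanishing (suc n) n<2K = trans (U-suc n k)
    (cong (_* Cat K) (k>n⇒nCk≡0 (≤-pred (≤-trans n<2K (≤-reflexive (2K≡1+m k))))))

  central : U (2 * K) K ≡ Cat K
  central = trans (U-at 0 (2K≡1+m k)) (trans (cong (_* Cat K) (nCn≡1 m)) (*-identityˡ (Cat K)))

  next : U (2 * K + 1) K ≡ (2 * K) * Cat K
  next = trans (U-at 1 (2K+j≡ k 1)) (cong (_* Cat K) (trans ([1+n]Cn≡1+n m) (sym (2K≡1+m k))))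

  [2+m]Cm≡K[2K+1] : suc (suc m) C m ≡ K * (2 * K + 1)
  [2+m]Cm≡K[2K+1] = *-cancelʳ-≡ (suc (suc m) C m) (K * (2 * K + 1)) 2
    (trans ([2+n]Cn*2 m) (quadratic k))
    where
    quadratic : ∀ i →
      suc (suc (suc (i + i))) * suc (suc (i + i)) ≡ suc i * (2 * suc i + 1) * 2
    quadratic = solve-∀

  next² : U (2 * K + 2) K ≡ (K * (2 * K + 1)) * Cat K
  next² = trans (U-at 2 (2K+j≡ k 2)) (cong (_* Cat K) [2+m]Cm≡K[2K+1])
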